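{- Let $X$ and $Y$ be finite nonempty sets and let $F: X \to 2^Y$ be a set-valued mapping. If $F$ admits a Hall partition, then $F$ satisfies the Hall condition.
   Context: A set-valued mapping $F: X \to 2^Y$ assigns to each $x \in X$ a (possibly empty) subset $F(x) \subset Y$. For $W \subset X$ put $F(W) = \bigcup_{x \in W} F(x)$; $\sharp$ denotes cardinality. $F$ satisfies the Hall condition if $\sharp F(W) \ge \sharp W$ for every $W \subset X$. For $W \subset X$, $F_W: X \setminus W \to 2^{Y}$ is the complement mapping $F_W(x) = F(x)\setminus F(W)$. These notions apply to any set-valued mapping $G$ on a finite set. A subset $W$ of the domain of $G$ is a critical set of $G$ if $W \neq \emptyset$ and $\sharp G(W) = \sharp W$; it is a non-reducible set of $G$ if $W \ne \emptyset$ and no proper subset of $W$ is a critical set of $G$. A tuple $(W_1, \ldots, W_m)$, $m \ge 1$, is a Hall partition of $F$ if $W_1, \ldots, W_m$ are nonempty pairwise disjoint sets with union $X$, and, writing $G_i = F_{W_1 \cup \cdots \cup W_{i-1}}$ (so $G_1 = F$): (i) $G_i(x) \neq \emptyset$ for all $x \in W_i$, $i = 1,\ldots,m$; (ii) $W_i$ is a non-reducible set of $G_i$ for $i=1,\ldots,m$; (iii) $W_i$ is a critical set of $G_i$ for $i = 1, \ldots, m-1$. -}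

module Defs where

open import Data.Nat using (ℕ; zero; suc; _≤_; _<_)
open import Data.Nat.Properties using (_<?_)
open import Data.Fin using (Fin; toℕ)
open import Data.Fin.Subset using (Subset; _∈_; _⊆_; _⊂_; _∪_; _─_; ∁; ⋃; ∣_∣; Nonempty; ⊥; ⊤; inside; outside)
open import Data.Vec using (_∷_; [])
open import Data.List using (List; filter; map; allFin)
open import Data.Product using (_×_; ∃)
open import Relation.Nullary using (¬_)
open import Relation.Binary.PropositionalEquality using (_≡_; _≢_)

SVMap : ℕ → ℕ → Set
SVMap n k = Fin n → Subset k

image : ∀ {n k} → SVMap n k → Subset n → Subset k
image {zero}  F []            = ⊥
image {suc n} F (inside ∷ W)  = F Fin.zero ∪ image (λ x → F (Fin.suc x)) W
image {suc n} F (outside ∷ W) = image (λ x → F (Fin.suc x)) W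

HallCondition : ∀ {n k} → SVMap n k → Set
HallCondition {n} F = (W : Subset n) → ∣ W ∣ ≤ ∣ image F W ∣

-- Complement mapping F_W(x) = F(x) \ F(W)   (its domain X \ W is tracked separately as ∁ W)
complMap : ∀ {n k} → SVMap n k → Subset n → SVMap n k
complMap F W x = F x ─ image F W

-- Notions for a set-valued mapping G whose domain is the subset D of Fin n.
-- W is a critical set of G (with domain D).
Critical : ∀ {n k} → Subset n → SVMap n k → Subset n → Set
Critical D G W = W ⊆ D × Nonempty W × ∣ image G W ∣ ≡ ∣ W ∣

NonReducible : ∀ {n k} → Subset n → SVMap n k → Subset n → Set
NonReducible D G W = W ⊆ D × Nonempty W × (∀ V → V ⊂ W → ¬ Critical D G V)

before : ∀ {n m} → (Fin m → Subset n) → Fin m → Subset n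
before {m = m} Ws i = ⋃ (map Ws (filter (λ j → toℕ j <? toℕ i) (allFin m)))

-- (W₁,…,W_m), m = suc m' ≥ 1, is a Hall partition of F.
-- G_i = F_{W₁ ∪ ⋯ ∪ W_{i-1}} with domain X \ (W₁ ∪ ⋯ ∪ W_{i-1}).
IsHallPartition : ∀ {n k} → SVMap n k → (m' : ℕ) → (Fin (suc m') → Subset n) → Set
IsHallPartition {n} F m' Ws =
  (∀ i → Nonempty (Ws i)) ×
  (∀ i j → i ≢ j → ∀ x → x ∈ Ws i → ¬ (x ∈ Ws j)) ×
  (∀ (x : Fin n) → ∃ λ i → x ∈ Ws i) ×
  (∀ i x → x ∈ Ws i → Nonempty (complMap F (before Ws i) x)) ×
  (∀ i → NonReducible (∁ (before Ws i)) (complMap F (before Ws i)) (Ws i)) ×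
  (∀ i → toℕ i < m' → Critical (∁ (before Ws i)) (complMap F (before Ws i)) (Ws i))

HasHallPartition : ∀ {n k} → SVMap n k → Set
HasHallPartition F = ∃ λ m' → ∃ λ Ws → IsHallPartition F m' Ws

{-# OPTIONS --safe #-}
-- Write Bᵢ = W₁ ∪ ⋯ ∪ Wᵢ₋₁ and Gᵢ = F_{Bᵢ}. Inside a single block Wᵢ the Hall
-- condition for Gᵢ holds because Wᵢ is non-reducible: removing one point x from
-- V ⊆ Wᵢ leaves a proper subset of Wᵢ, which is not critical, so by induction
-- it has strictly more Gᵢ-neighbours than points, and x itself has a neighbour.
-- Downward induction on i then shows that Gᵢ satisfies the Hall condition on
-- X ∖ Bᵢ: a set W splits into W ∩ Wᵢ and W ∖ Wᵢ ⊆ X ∖ Bᵢ₊₁, whose neighbourhoods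
-- under Gᵢ and Gᵢ₊₁ are disjoint subsets of Gᵢ(W). For i = 1 this is the
-- theorem.
module Submission where

open import Defs
open import Data.Nat using (ℕ; suc; _+_; _≤_; _<_; z≤n)
open import Data.Nat.Properties
  using (+-suc; +-identityʳ; +-mono-≤; +-monoˡ-≤; ≤-refl; ≤-trans; ≤-reflexive; ≤∧≢⇒<;
         n≮0; m<n⇒m<1+n; m<1+n⇒m<n∨m≡n; m≤n⇒m<n∨m≡n; _<?_; module ≤-Reasoning)
open import Data.Fin as Fin using (Fin; toℕ; fromℕ; inject₁)
open import Data.Fin.Properties using (toℕ-injective; toℕ-inject₁; toℕ-fromℕ; toℕ≤pred[n])
open import Data.Fin.Induction using (>-weakInduction)
open import Data.Fin.Subset
  using (Subset; _∈_; _∉_; _⊆_; _⊂_; _∪_; _∩_; _─_; _-_; ∁; ⋃; ∣_∣; Nonempty; Empty;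
         ⁅_⁆; inside; outside)
open import Data.Fin.Subset.Properties
  using (x∈p∪q⁺; x∈p∪q⁻; x∈p∩q⁻; p─q⊆p; x∈p∧x∉q⇒x∈p─q; x∈⁅x⁆; x∈⁅y⁆⇒x≡y;
         ∣⁅x⁆∣≡1; ∣p∩q∣≤∣q∣; p⊆q⇒∣p∣≤∣q∣; x∈p⇒p-x⊂p; Empty-unique; ∣⊥∣≡0;
         x∉p⇒x∈∁p; x∈∁p⇒x∉p; nonempty?; ∉⊥; drop-there)
open import Data.Fin.Subset.Induction using (Acc; acc; ⊂-wellFounded)
open import Data.Vec using (_∷_; []; here; there)
open import Data.List using (List; filter; map; allFin)
open import Data.List.Relation.Unary.Any using (Any; here; there)
import Data.List.Membership.Propositional as List
open import Data.List.Membership.Propositional.Properties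
  using (∈-map⁺; ∈-map⁻; ∈-filter⁺; ∈-filter⁻; ∈-allFin)
open import Data.Product using (_×_; ∃; _,_; proj₁; proj₂)
import Data.Product as Product
open import Data.Sum using (inj₁; inj₂; [_,_])
open import Function using (_∘_; id)
open import Relation.Nullary using (yes; no; contradiction)
open import Relation.Binary.PropositionalEquality
  using (_≡_; _≢_; refl; sym; trans; cong; subst; module ≡-Reasoning)

private
  variable
    n k : ℕ
    x : Fin n
    p q : Subset n

x∈p─q⁻ : ∀ (p q : Subset n) → x ∈ p ─ q → x ∈ p × x ∉ q
x∈p─q⁻ (inside  ∷ p) (outside ∷ q) here = here , λ ()
x∈p─q⁻ {x = Fin.zero} (outside ∷ p) (outside ∷ q) ()
x∈p─q⁻ {x = Fin.zero} (_       ∷ p) (inside  ∷ q) ()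
x∈p─q⁻ (_ ∷ p) (_ ∷ q) (there x∈p─q) =
  Product.map there (λ x∉q → x∉q ∘ drop-there) (x∈p─q⁻ p q x∈p─q)

x∈⋃⁺ : ∀ {ps : List (Subset n)} → Any (x ∈_) ps → x ∈ ⋃ ps
x∈⋃⁺ (here x∈p)    = x∈p∪q⁺ (inj₁ x∈p)
x∈⋃⁺ (there x∈ps) = x∈p∪q⁺ (inj₂ (x∈⋃⁺ x∈ps))

x∈⋃⁻ : ∀ (ps : List (Subset n)) → x ∈ ⋃ ps → Any (x ∈_) ps
x∈⋃⁻ List.[]       x∈⊥   = contradiction x∈⊥ ∉⊥
x∈⋃⁻ (p List.∷ ps) x∈p∪ = [ here , there ∘ x∈⋃⁻ ps ] (x∈p∪q⁻ p (⋃ ps) x∈p∪)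

Empty⇒∣p∣≡0 : Empty p → ∣ p ∣ ≡ 0
Empty⇒∣p∣≡0 {n} p-empty = trans (cong ∣_∣ (Empty-unique p-empty)) (∣⊥∣≡0 n)

Nonempty⇒∣p∣>0 : Nonempty p → 0 < ∣ p ∣
Nonempty⇒∣p∣>0 {p = p} (x , x∈p) = subst (_≤ ∣ p ∣) (∣⁅x⁆∣≡1 x)
  (p⊆q⇒∣p∣≤∣q∣ (λ y∈⁅x⁆ → subst (_∈ p) (sym (x∈⁅y⁆⇒x≡y x y∈⁅x⁆)) x∈p))

∣p∩q∣+∣p─q∣≡∣p∣ : ∀ (p q : Subset n) → ∣ p ∩ q ∣ + ∣ p ─ q ∣ ≡ ∣ p ∣
∣p∩q∣+∣p─q∣≡∣p∣ []            []            = refl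
∣p∩q∣+∣p─q∣≡∣p∣ (inside  ∷ p) (inside  ∷ q) = cong suc (∣p∩q∣+∣p─q∣≡∣p∣ p q)
∣p∩q∣+∣p─q∣≡∣p∣ (inside  ∷ p) (outside ∷ q) =
  trans (+-suc ∣ p ∩ q ∣ ∣ p ─ q ∣) (cong suc (∣p∩q∣+∣p─q∣≡∣p∣ p q))
∣p∩q∣+∣p─q∣≡∣p∣ (outside ∷ p) (inside  ∷ q) = ∣p∩q∣+∣p─q∣≡∣p∣ p q
∣p∩q∣+∣p─q∣≡∣p∣ (outside ∷ p) (outside ∷ q) = ∣p∩q∣+∣p─q∣≡∣p∣ p q

∣p∪q∣+∣p∩q∣≡∣p∣+∣q∣ : ∀ (p q : Subset n) → ∣ p ∪ q ∣ + ∣ p ∩ q ∣ ≡ ∣ p ∣ + ∣ q ∣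
∣p∪q∣+∣p∩q∣≡∣p∣+∣q∣ []            []            = refl
∣p∪q∣+∣p∩q∣≡∣p∣+∣q∣ (inside  ∷ p) (inside  ∷ q) = cong suc (begin
  ∣ p ∪ q ∣ + suc ∣ p ∩ q ∣  ≡⟨ +-suc ∣ p ∪ q ∣ ∣ p ∩ q ∣ ⟩
  suc (∣ p ∪ q ∣ + ∣ p ∩ q ∣) ≡⟨ cong suc (∣p∪q∣+∣p∩q∣≡∣p∣+∣q∣ p q) ⟩
  suc (∣ p ∣ + ∣ q ∣)         ≡⟨ +-suc ∣ p ∣ ∣ q ∣ ⟨
  ∣ p ∣ + suc ∣ q ∣           ∎)
  where open ≡-Reasoning
∣p∪q∣+∣p∩q∣≡∣p∣+∣q∣ (inside  ∷ p) (outside ∷ q) = cong suc (∣p∪q∣+∣p∩q∣≡∣p∣+∣q∣ p q)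
∣p∪q∣+∣p∩q∣≡∣p∣+∣q∣ (outside ∷ p) (inside  ∷ q) =
  trans (cong suc (∣p∪q∣+∣p∩q∣≡∣p∣+∣q∣ p q)) (sym (+-suc ∣ p ∣ ∣ q ∣))
∣p∪q∣+∣p∩q∣≡∣p∣+∣q∣ (outside ∷ p) (outside ∷ q) = ∣p∪q∣+∣p∩q∣≡∣p∣+∣q∣ p q

Empty[p∩q]⇒∣p∪q∣≡∣p∣+∣q∣ : Empty (p ∩ q) → ∣ p ∪ q ∣ ≡ ∣ p ∣ + ∣ q ∣
Empty[p∩q]⇒∣p∪q∣≡∣p∣+∣q∣ {p = p} {q} p∩q-empty = begin
  ∣ p ∪ q ∣                ≡⟨ +-identityʳ ∣ p ∪ q ∣ ⟨
  ∣ p ∪ q ∣ + 0            ≡⟨ cong (∣ p ∪ q ∣ +_) (Empty⇒∣p∣≡0 p∩q-empty) ⟨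
  ∣ p ∪ q ∣ + ∣ p ∩ q ∣    ≡⟨ ∣p∪q∣+∣p∩q∣≡∣p∣+∣q∣ p q ⟩
  ∣ p ∣ + ∣ q ∣            ∎
  where open ≡-Reasoning

image⁺ : ∀ (F : SVMap n k) (W : Subset n) {x y} → x ∈ W → y ∈ F x → y ∈ image F W
image⁺ F (inside  ∷ W) here        y∈Fx = x∈p∪q⁺ (inj₁ y∈Fx)
image⁺ F (inside  ∷ W) (there x∈W) y∈Fx = x∈p∪q⁺ (inj₂ (image⁺ (F ∘ Fin.suc) W x∈W y∈Fx))
image⁺ F (outside ∷ W) (there x∈W) y∈Fx = image⁺ (F ∘ Fin.suc) W x∈W y∈Fx

image⁻ : ∀ (F : SVMap n k) (W : Subset n) {y} → y ∈ image F W → ∃ λ x → x ∈ W × y ∈ F x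
image⁻ {n = 0}     F []            y∈⊥ = contradiction y∈⊥ ∉⊥
image⁻ {n = suc n} F (inside  ∷ W) y∈  with x∈p∪q⁻ (F Fin.zero) _ y∈
... | inj₁ y∈F0 = Fin.zero , here , y∈F0
... | inj₂ y∈FW = Product.map Fin.suc (Product.map₁ there) (image⁻ (F ∘ Fin.suc) W y∈FW)
image⁻ {n = suc n} F (outside ∷ W) y∈  =
  Product.map Fin.suc (Product.map₁ there) (image⁻ (F ∘ Fin.suc) W y∈)

image-mono : ∀ {F G : SVMap n k} {V W} → (∀ x → F x ⊆ G x) → V ⊆ W → image F V ⊆ image G W
image-mono {F = F} {G} {V} {W} F⊆G V⊆W y∈FV =
  let x , x∈V , y∈Fx = image⁻ F V y∈FV in image⁺ G W (V⊆W x∈V) (F⊆G x y∈Fx)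

complMap⊆ : ∀ (F : SVMap n k) B x → complMap F B x ⊆ F x
complMap⊆ F B x = p─q⊆p (F x) (image F B)

complMap-antitone : ∀ (F : SVMap n k) {B B′} → B ⊆ B′ → ∀ x → complMap F B′ x ⊆ complMap F B x
complMap-antitone F {B} {B′} B⊆B′ x y∈ =
  let y∈Fx , y∉FB′ = x∈p─q⁻ (F x) (image F B′) y∈
  in x∈p∧x∉q⇒x∈p─q y∈Fx (y∉FB′ ∘ image-mono (λ _ → id) B⊆B′)

HallOn : Subset n → SVMap n k → Set
HallOn D G = ∀ W → W ⊆ D → ∣ W ∣ ≤ ∣ image G W ∣

nonReducible⇒HallOn : ∀ {D P : Subset n} {G : SVMap n k} →
  (∀ {x} → x ∈ P → Nonempty (G x)) → NonReducible D G P → HallOn P G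
nonReducible⇒HallOn {P = P} {G} G-nonempty (P⊆D , _ , noneCritical) V V⊆P =
  go V (⊂-wellFounded V) V⊆P
  where
  go : ∀ V → Acc _⊂_ V → V ⊆ P → ∣ V ∣ ≤ ∣ image G V ∣
  go V _ _ with nonempty? V
  go V _         _   | no  V-empty   = ≤-trans (≤-reflexive (Empty⇒∣p∣≡0 V-empty)) z≤n
  go V (acc rec) V⊆P | yes (x , x∈V) = begin
    ∣ V ∣                      ≡⟨ ∣p∩q∣+∣p─q∣≡∣p∣ V ⁅ x ⁆ ⟨
    ∣ V ∩ ⁅ x ⁆ ∣ + ∣ V - x ∣  ≤⟨ +-monoˡ-≤ ∣ V - x ∣ ∣V∩⁅x⁆∣≤1 ⟩
    suc ∣ V - x ∣              ≤⟨ suc∣V-x∣≤∣GV∣ ⟩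
    ∣ image G V ∣              ∎
    where
    open ≤-Reasoning
    ∣V∩⁅x⁆∣≤1 : ∣ V ∩ ⁅ x ⁆ ∣ ≤ 1
    ∣V∩⁅x⁆∣≤1 = ≤-trans (∣p∩q∣≤∣q∣ V ⁅ x ⁆) (≤-reflexive (∣⁅x⁆∣≡1 x))
    V-x⊆V : V - x ⊆ V
    V-x⊆V = p─q⊆p V ⁅ x ⁆
    V-x⊂P : V - x ⊂ P
    V-x⊂P = V⊆P ∘ V-x⊆V , x , V⊆P x∈V , λ x∈V-x → proj₂ (x∈p─q⁻ V ⁅ x ⁆ x∈V-x) (x∈⁅x⁆ x)
    suc∣V-x∣≤∣GV∣ : suc ∣ V - x ∣ ≤ ∣ image G V ∣
    suc∣V-x∣≤∣GV∣ with nonempty? (V - x)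
    ... | no V-x-empty = subst (λ s → suc s ≤ ∣ image G V ∣) (sym (Empty⇒∣p∣≡0 V-x-empty))
      (Nonempty⇒∣p∣>0 (Product.map₂ (image⁺ G V x∈V) (G-nonempty (V⊆P x∈V))))
    ... | yes V-x-nonempty = ≤-trans (≤∧≢⇒< IH notCritical)
      (p⊆q⇒∣p∣≤∣q∣ (image-mono (λ _ → id) V-x⊆V))
      where
      IH : ∣ V - x ∣ ≤ ∣ image G (V - x) ∣
      IH = go (V - x) (rec (x∈p⇒p-x⊂p x∈V)) (V⊆P ∘ V-x⊆V)
      notCritical : ∣ V - x ∣ ≢ ∣ image G (V - x) ∣
      notCritical eq = noneCritical (V - x) V-x⊂P (P⊆D ∘ V⊆P ∘ V-x⊆V , V-x-nonempty , sym eq)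

-- B′ plays the role of B ∪ P; only the three inclusions are needed.
HallOn-∁-step : ∀ (F : SVMap n k) {B P B′} → B ⊆ B′ → P ⊆ B′ → B′ ⊆ B ∪ P →
  HallOn P (complMap F B) → HallOn (∁ B′) (complMap F B′) → HallOn (∁ B) (complMap F B)
HallOn-∁-step {n} {k} F {B} {P} {B′} B⊆B′ P⊆B′ B′⊆B∪P hall-P hall-∁B′ W W⊆∁B = begin
  ∣ W ∣                                 ≡⟨ ∣p∩q∣+∣p─q∣≡∣p∣ W P ⟨
  ∣ W ∩ P ∣ + ∣ W ─ P ∣                 ≤⟨ +-mono-≤ (hall-P _ (proj₂ ∘ x∈p∩q⁻ W P))
                                                    (hall-∁B′ _ W─P⊆∁B′) ⟩
  ∣ image G (W ∩ P) ∣ + ∣ image G′ (W ─ P) ∣ ≡⟨ Empty[p∩q]⇒∣p∪q∣≡∣p∣+∣q∣ disjoint ⟨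
  ∣ image G (W ∩ P) ∪ image G′ (W ─ P) ∣ ≤⟨ p⊆q⇒∣p∣≤∣q∣ ([ GA⊆GW , G′C⊆GW ] ∘ x∈p∪q⁻ _ _) ⟩
  ∣ image G W ∣                         ∎
  where
  open ≤-Reasoning
  G G′ : SVMap n k
  G = complMap F B
  G′ = complMap F B′
  W─P⊆∁B′ : W ─ P ⊆ ∁ B′
  W─P⊆∁B′ y∈W─P = x∉p⇒x∈∁p λ y∈B′ →
    let y∈W , y∉P = x∈p─q⁻ W P y∈W─P
    in [ x∈∁p⇒x∉p (W⊆∁B y∈W) , y∉P ] (x∈p∪q⁻ B P (B′⊆B∪P y∈B′))
  GA⊆GW : image G (W ∩ P) ⊆ image G W
  GA⊆GW = image-mono (λ _ → id) (proj₁ ∘ x∈p∩q⁻ W P)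
  G′C⊆GW : image G′ (W ─ P) ⊆ image G W
  G′C⊆GW = image-mono (complMap-antitone F B⊆B′) (p─q⊆p W P)
  -- Whatever G sees from W ∩ P ⊆ B′ is removed in G′.
  disjoint : Empty (image G (W ∩ P) ∩ image G′ (W ─ P))
  disjoint (y , y∈∩) =
    let y∈GA , y∈G′C = x∈p∩q⁻ _ _ y∈∩
        x , x∈A , y∈Gx = image⁻ G (W ∩ P) y∈GA
        x′ , _ , y∈G′x′ = image⁻ G′ (W ─ P) y∈G′C
    in proj₂ (x∈p─q⁻ (F x′) _ y∈G′x′)
         (image⁺ F B′ (P⊆B′ (proj₂ (x∈p∩q⁻ W P x∈A))) (complMap⊆ F B x y∈Gx))

module _ {m} (Ws : Fin (suc m) → Subset n) where

  x∈before⁺ : ∀ {i j} → toℕ i < toℕ j → x ∈ Ws i → x ∈ before Ws j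
  x∈before⁺ {i = i} {j} i<j x∈Wsᵢ =
    x∈⋃⁺ (List.lose (∈-map⁺ Ws (∈-filter⁺ (λ i → toℕ i <? toℕ j) (∈-allFin i) i<j)) x∈Wsᵢ)

  x∈before⁻ : ∀ {j} → x ∈ before Ws j → ∃ λ i → toℕ i < toℕ j × x ∈ Ws i
  x∈before⁻ {j = j} x∈Bⱼ with List.find (x∈⋃⁻ _ x∈Bⱼ)
  ... | _ , p∈ , x∈p with ∈-map⁻ Ws p∈
  ...   | i , i∈ , refl = i , proj₂ (∈-filter⁻ (λ i → toℕ i <? toℕ j) {xs = allFin _} i∈) , x∈p

  x∉before-zero : x ∉ before Ws Fin.zero
  x∉before-zero x∈B₀ = let _ , i<0 , _ = x∈before⁻ x∈B₀ in n≮0 i<0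

  before-inject₁⊆before-suc : ∀ i → before Ws (inject₁ i) ⊆ before Ws (Fin.suc i)
  before-inject₁⊆before-suc i x∈B = let j , j<i , x∈Wsⱼ = x∈before⁻ x∈B in
    x∈before⁺ (m<n⇒m<1+n (subst (toℕ j <_) (toℕ-inject₁ i) j<i)) x∈Wsⱼ

  Ws-inject₁⊆before-suc : ∀ i → Ws (inject₁ i) ⊆ before Ws (Fin.suc i)
  Ws-inject₁⊆before-suc i = x∈before⁺ (subst (_< suc (toℕ i)) (sym (toℕ-inject₁ i)) ≤-refl)

  before-suc⊆before∪Ws : ∀ i → before Ws (Fin.suc i) ⊆ before Ws (inject₁ i) ∪ Ws (inject₁ i)
  before-suc⊆before∪Ws i {x} x∈B with x∈before⁻ x∈B
  ... | j , j<1+i , x∈Wsⱼ with m<1+n⇒m<n∨m≡n j<1+i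
  ...   | inj₁ j<i = x∈p∪q⁺ (inj₁ (x∈before⁺ (subst (toℕ j <_) (sym (toℕ-inject₁ i)) j<i) x∈Wsⱼ))
  ...   | inj₂ j≡i = x∈p∪q⁺ (inj₂ (subst (λ j → x ∈ Ws j)
                                        (toℕ-injective (trans j≡i (sym (toℕ-inject₁ i)))) x∈Wsⱼ))

  ∁before-last⊆Ws-last : (∀ x → ∃ λ i → x ∈ Ws i) → ∁ (before Ws (fromℕ m)) ⊆ Ws (fromℕ m)
  ∁before-last⊆Ws-last covers {x} x∉B with covers x
  ... | j , x∈Wsⱼ with m≤n⇒m<n∨m≡n (toℕ≤pred[n] j)
  ...   | inj₁ j<m = contradiction (x∈before⁺ (subst (toℕ j <_) (sym (toℕ-fromℕ m)) j<m) x∈Wsⱼ)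
                                   (x∈∁p⇒x∉p x∉B)
  ...   | inj₂ j≡m = subst (λ j → x ∈ Ws j) (toℕ-injective (trans j≡m (sym (toℕ-fromℕ m)))) x∈Wsⱼ

HallOn-∁before : ∀ (F : SVMap n k) {m} (Ws : Fin (suc m) → Subset n) → IsHallPartition F m Ws →
  ∀ i → HallOn (∁ (before Ws i)) (complMap F (before Ws i))
HallOn-∁before {n} {k} F Ws (_ , _ , covers , nonempty , nonReducible , _) =
  >-weakInduction (λ i → HallOn (∁ (before Ws i)) (G i)) last step
  where
  G : ∀ i → SVMap n k
  G i = complMap F (before Ws i)
  hall-Ws : ∀ i → HallOn (Ws i) (G i)
  hall-Ws i = nonReducible⇒HallOn (nonempty i _) (nonReducible i)
  last : HallOn (∁ (before Ws (fromℕ _))) (G (fromℕ _))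
  last W W⊆∁B = hall-Ws _ W (λ x∈W → ∁before-last⊆Ws-last Ws covers (W⊆∁B x∈W))
  step : ∀ i → HallOn (∁ (before Ws (Fin.suc i))) (G (Fin.suc i)) →
               HallOn (∁ (before Ws (inject₁ i))) (G (inject₁ i))
  step i = HallOn-∁-step F (before-inject₁⊆before-suc Ws i) (Ws-inject₁⊆before-suc Ws i)
             (before-suc⊆before∪Ws Ws i) (hall-Ws (inject₁ i))

theorem3p2 : (n k : ℕ) → 0 < n → 0 < k → (F : SVMap n k) →
    HasHallPartition F → HallCondition F
theorem3p2 n k _ _ F (m , Ws , isHallPartition) W = begin
  ∣ W ∣            ≤⟨ HallOn-∁before F Ws isHallPartition Fin.zero W W⊆∁B₀ ⟩
  ∣ image G₀ W ∣   ≤⟨ p⊆q⇒∣p∣≤∣q∣ (image-mono (complMap⊆ F B₀) id) ⟩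
  ∣ image F W ∣    ∎
  where
  open ≤-Reasoning
  B₀ : Subset n
  B₀ = before Ws Fin.zero
  G₀ : SVMap n k
  G₀ = complMap F B₀
  W⊆∁B₀ : W ⊆ ∁ B₀
  W⊆∁B₀ _ = x∉p⇒x∈∁p (x∉before-zero Ws)
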